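{- Let $\mathcal{M}$ be an $n$-maniplex and let $\{F_1,\dots,F_k\}$ be a chain of proper faces of the poset $\mathcal{P}_\mathcal{M}$. Then $\bigcap_{j=1}^k F_j$ (the set of flags lying in every $F_j$) is non-empty.
   Context: Write $[n]=\{0,1,\dots,n-1\}$. An $n$-maniplex is a simple graph $\mathcal{M}$ whose edges are coloured with colours from $[n]$ so that every vertex (called a flag) is incident to exactly one edge of each colour, and such that for all $i,j\in[n]$ with $|i-j|>1$, every connected component of the subgraph formed by all vertices and the edges of colours $i$ and $j$ is a $4$-cycle. For $A\subset[n]$, $\mathcal{M}_A$ denotes the spanning subgraph with exactly the edges with colours in $A$. For $i\in[n]$, an $i$-face of $\mathcal{M}$ is a connected component of $\mathcal{M}_{[n]\setminus\{i\}}$; it has rank $i$. The poset $\mathcal{P}_\mathcal{M}$ consists of all faces of $\mathcal{M}$ (the proper faces) together with two extra elements $F_{ -1}$ (rank $-1$, the minimum) and $F_n$ (rank $n$, the maximum); for an $i$-face $F$ and a $j$-face $G$ of $\mathcal{M}$, $F\le G$ iff $i\le j$ and $F\cap G\neq\emptyset$. -}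

module Defs where

open import Data.Nat using (ℕ; _<_; _≤_; ∣_-_∣)
open import Data.Fin using (Fin; toℕ)
open import Data.Product using (_×_; ∃)
open import Data.Sum using (_⊎_)
open import Relation.Binary.PropositionalEquality using (_≡_; _≢_)

-- An n-maniplex, presented by its flag set and, for each colour i, the
-- function r i sending a flag to its unique i-neighbour (the other end of
-- the unique edge of colour i at that flag).
record Maniplex (n : ℕ) : Set₁ where
  field
    Flag   : Set
    r      : Fin n → Flag → Flag
    -- the i-edge at x joins x and r i x, so it is also the i-edge at r i x
    invol  : ∀ i x → r i (r i x) ≡ x
    noLoop : ∀ i x → r i x ≢ x
    simple : ∀ i j x → i ≢ j → r i x ≢ r j x
    -- for |i - j| > 1 every component of M_{i,j} is a 4-cycle:
    -- x , r i x , r j x , r i (r j x) = r j (r i x), with r i (r j x) ≠ x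
    -- (the other distinctness conditions follow from noLoop / simple)
    comm   : ∀ i j x → 1 < ∣ toℕ i - toℕ j ∣ → r i (r j x) ≡ r j (r i x)
    square : ∀ i j x → 1 < ∣ toℕ i - toℕ j ∣ → r i (r j x) ≢ x

open Maniplex public

-- Conn M i x y : y is in the connected component of x in M_{[n] \ {i}}
data Conn {n : ℕ} (M : Maniplex n) (i : Fin n) (x : Flag M) : Flag M → Set where
  here : Conn M i x x
  step : ∀ {y} (j : Fin n) → j ≢ i → Conn M i x y → Conn M i x (r M j y)

-- A proper face: an i-face, i.e. the component of M_{[n] \ {i}} containing
-- the flag `base`.
record Face {n : ℕ} (M : Maniplex n) : Set where
  constructor face
  field
    rank : Fin n
    base : Flag M

open Face public

_∈F_ : {n : ℕ} {M : Maniplex n} → Flag M → Face M → Set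
_∈F_ {M = M} y F = Conn M (rank F) (base F) y

_≤F_ : {n : ℕ} {M : Maniplex n} → Face M → Face M → Set
_≤F_ {M = M} F G = toℕ (rank F) ≤ toℕ (rank G) × ∃ λ (x : Flag M) → (x ∈F F) × (x ∈F G)

IsChain : {n k : ℕ} {M : Maniplex n} → (Fin k → Face M) → Set
IsChain F = ∀ a b → (F a ≤F F b) ⊎ (F b ≤F F a)

-- Remove a face F_m of maximal rank and
-- let x lie in all the other faces; among those pick F_p of maximal rank i,
-- and a flag y in F_p ∩ F_m. A walk from x to y inside F_p avoids colour i,
-- and since colours differing by more than one commute, it can be sorted into
-- a part using colours above i followed by a part using colours below i.
-- The flag z between the two parts is the required one: the first part stays
-- in every face of rank at most i through x, the second in every face of
-- rank at least i through y.
module Submission where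

open import Defs
open import Data.Nat using (ℕ; zero; suc; z≤n; s≤s; ∣_-_∣)
  renaming (_<_ to _<ℕ_; _≤_ to _≤ℕ_)
open import Data.Nat.Properties using (≤-refl; ≤-trans; ≤-total; ≤-<-trans; <-≤-trans)
open import Data.Fin using (Fin; toℕ; _<_; _≤_; punchIn; punchOut; _≟_)
open import Data.Fin.Properties using (<-cmp; <⇒≢; punchIn-punchOut)
open import Data.Product using (∃; _×_; _,_)
open import Data.Sum using (inj₁; inj₂)
open import Function using (_∘_)
open import Relation.Binary using (tri<; tri≈; tri>)
open import Relation.Nullary using (yes; no; contradiction)
open import Relation.Binary.PropositionalEquality using (_≢_; refl; sym; subst)

m<n<o⇒1<∣o-m∣ : ∀ {m n o} → m <ℕ n → n <ℕ o → 1 <ℕ ∣ o - m ∣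
m<n<o⇒1<∣o-m∣ {zero} {suc n} {suc (suc o)} (s≤s z≤n) (s≤s (s≤s _)) = s≤s (s≤s z≤n)
m<n<o⇒1<∣o-m∣ {suc m} {suc n} {suc o} (s≤s m<n) (s≤s n<o) = m<n<o⇒1<∣o-m∣ m<n n<o

argmax : ∀ {k} (f : Fin (suc k) → ℕ) → ∃ λ m → ∀ a → f a ≤ℕ f m
argmax {zero} f = Fin.zero , λ { Fin.zero → ≤-refl }
argmax {suc k} f with argmax (f ∘ Fin.suc)
... | m , f≤fm with ≤-total (f Fin.zero) (f (Fin.suc m))
... | inj₁ f0≤fm = Fin.suc m , λ { Fin.zero → f0≤fm ; (Fin.suc a) → f≤fm a }
... | inj₂ fm≤f0 = Fin.zero , λ { Fin.zero → ≤-refl ; (Fin.suc a) → ≤-trans (f≤fm a) fm≤f0 }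

punchIn-elim : ∀ {k} {P : Fin (suc k) → Set} (m : Fin (suc k)) →
  P m → (∀ b → P (punchIn m b)) → ∀ a → P a
punchIn-elim {P = P} m Pm P∘punchIn a with m ≟ a
... | yes refl = Pm
... | no m≢a = subst P (punchIn-punchOut m≢a) (P∘punchIn (punchOut m≢a))

module _ {n : ℕ} (M : Maniplex n) where

  data Walk (P : Fin n → Set) (x : Flag M) : Flag M → Set where
    here : Walk P x x
    step : ∀ {y} (j : Fin n) → P j → Walk P x y → Walk P x (r M j y)

  _++_ : ∀ {P x y z} → Walk P x y → Walk P y z → Walk P x z
  v ++ here = v
  v ++ step j pj w = step j pj (v ++ w)

  reverse : ∀ {P x y} → Walk P x y → Walk P y x
  reverse here = here
  reverse {P} (step {y} j pj w) =
    subst (Walk P _) (invol M j y) (step j pj here) ++ reverse w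

  Conn⇒Walk : ∀ {i x y} → Conn M i x y → Walk (_≢ i) x y
  Conn⇒Walk here = here
  Conn⇒Walk (step j j≢i c) = step j j≢i (Conn⇒Walk c)

  ∈F-walk : ∀ {P} {G : Face M} {x y} → (∀ j → P j → j ≢ rank G) → x ∈F G → Walk P x y → y ∈F G
  ∈F-walk P⇒≢ x∈G here = x∈G
  ∈F-walk P⇒≢ x∈G (step j pj w) = step j (P⇒≢ j pj) (∈F-walk P⇒≢ x∈G w)

  walk-in-face : ∀ {G : Face M} {x y} → x ∈F G → y ∈F G → Walk (_≢ rank G) x y
  walk-in-face x∈G y∈G = reverse (Conn⇒Walk x∈G) ++ Conn⇒Walk y∈G

  r-walk-below : ∀ {i j : Fin n} {x y} → i < j → Walk (_< i) x y → Walk (_< i) (r M j x) (r M j y)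
  r-walk-below i<j here = here
  r-walk-below {i} {j} {x} i<j (step {y} c c<i w) =
    subst (Walk (_< i) (r M j x)) (sym (comm M j c y (m<n<o⇒1<∣o-m∣ c<i i<j)))
      (step c c<i (r-walk-below i<j w))

  sort-walk : ∀ {i x y} → Walk (_≢ i) x y → ∃ λ z → Walk (i <_) x z × Walk (_< i) z y
  sort-walk {x = x} here = x , here , here
  sort-walk {i} (step j j≢i w) with sort-walk w | <-cmp j i
  ... | z , above , below | tri< j<i _ _ = z , above , step j j<i below
  ... | _ , _ , _ | tri≈ _ j≡i _ = contradiction j≡i j≢i
  ... | z , above , below | tri> _ _ i<j = r M j z , step j i<j above , r-walk-below i<j below

  meet-across : ∀ {i x y} → Walk (_≢ i) x y → ∃ λ z →
    (∀ (G : Face M) → rank G ≤ i → x ∈F G → z ∈F G) × (∀ (H : Face M) → i ≤ rank H → y ∈F H → z ∈F H)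
  meet-across w with sort-walk w
  ... | z , above , below =
    z , (λ G G≤i x∈G → ∈F-walk (λ j i<j → <⇒≢ (≤-<-trans G≤i i<j) ∘ sym) x∈G above)
      , (λ H i≤H y∈H → ∈F-walk (λ j j<i → <⇒≢ (<-≤-trans j<i i≤H)) y∈H (reverse below))

chain-meets : ∀ {n k} {M : Maniplex n} {F : Fin k → Face M} → IsChain F →
  ∀ a b → ∃ λ x → x ∈F F a × x ∈F F b
chain-meets chain a b with chain a b
... | inj₁ (_ , x , x∈a , x∈b) = x , x∈a , x∈b
... | inj₂ (_ , x , x∈b , x∈a) = x , x∈a , x∈b

lemma3p2 : {n : ℕ} (M : Maniplex n) (k : ℕ) (F : Fin (suc k) → Face M) →
    IsChain F → ∃ λ (x : Flag M) → ∀ a → x ∈F F a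
lemma3p2 M zero F _ = base (F Fin.zero) , λ { Fin.zero → here }
lemma3p2 M (suc k) F chain
  with argmax (toℕ ∘ rank ∘ F)
... | m , F≤Fm
  with lemma3p2 M k (F ∘ punchIn m) (λ a b → chain (punchIn m a) (punchIn m b))
... | x , x∈F
  with argmax (toℕ ∘ rank ∘ F ∘ punchIn m)
... | p , F≤Fp
  with chain-meets chain (punchIn m p) m
... | y , y∈Fp , y∈Fm
  with meet-across M (walk-in-face M (x∈F p) y∈Fp)
... | z , lower , upper =
  z , punchIn-elim m (upper (F m) (F≤Fm (punchIn m p)) y∈Fm)
                     (λ b → lower (F (punchIn m b)) (F≤Fp b) (x∈F b))
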